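{- For all integers $k>\ell\ge2$, there exist positive integers $p_0,d$ such that whenever $p\ge p_0$ is a prime and $\mathcal{I}\subseteq\binom{[k]}{\ell}$, there exist $d$-dimensional subspaces $V^{(1)},\dots,V^{(k)}$ of $\mathbb{F}_p^{\ell d}$ such that: (i) whenever $I\in\binom{[k]}{\ell}\setminus\mathcal{I}$, $\dim\sum_{i\in I}V^{(i)}=\ell d$, i.e., $\mathbb{F}_p^{\ell d}=\bigoplus_{i\in I}V^{(i)}$; (ii) whenever $I\in\mathcal{I}$, $\dim\sum_{i\in I}V^{(i)}=\ell d-1$; (iii) whenever $I\in\binom{[k]}{\ell+1}$, $\dim\sum_{i\in I}V^{(i)}=\ell d$.
   Context: $\binom{[k]}{j}$ denotes the set of $j$-element subsets of $\{1,\dots,k\}$; $\mathbb F_p$ is the field with $p$ elements. -}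

module Defs where

open import Data.Nat using (ℕ; zero; suc; _+_; _*_)
open import Data.Fin using (Fin; zero; suc)
open import Data.Fin.Subset using (Subset)
open import Data.Vec using (lookup)
open import Data.Bool using (if_then_else_)
open import Data.Product using (Σ; _×_)
open import Relation.Binary.PropositionalEquality using (_≡_)

sumFin : (m : ℕ) → (Fin m → ℕ) → ℕ
sumFin zero    f = 0
sumFin (suc m) f = f zero + sumFin m (λ i → f (suc i))

-- Elements of F_p are represented by natural numbers, equality taken mod p.
-- a ≡ b (mod p)
EqMod : ℕ → ℕ → ℕ → Set
EqMod p a b = Σ ℕ λ x → Σ ℕ λ y → a + x * p ≡ b + y * p

Vecp : ℕ → Set
Vecp n = Fin n → ℕ

lin : {n : ℕ} (m : ℕ) → (Fin m → Vecp n) → (Fin m → ℕ) → Vecp n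
lin m g c t = sumFin m (λ i → c i * g i t)

VecEq : {n : ℕ} → ℕ → Vecp n → Vecp n → Set
VecEq p v w = ∀ t → EqMod p (v t) (w t)

LinIndep : {n : ℕ} → ℕ → (m : ℕ) → (Fin m → Vecp n) → Set
LinIndep p m g = ∀ (c : Fin m → ℕ) → VecEq p (lin m g c) (λ _ → 0) → ∀ i → EqMod p (c i) 0

InSpan : {n : ℕ} → ℕ → (m : ℕ) → (Fin m → Vecp n) → Vecp n → Set
InSpan p m g v = Σ (Fin m → ℕ) λ c → VecEq p (lin m g c) v

HasDim : {n : ℕ} → ℕ → (Vecp n → Set) → ℕ → Set
HasDim {n} p S r =
  Σ (Fin r → Vecp n) λ u →
    (∀ a → S (u a)) × LinIndep p r u × (∀ v → S v → InSpan p r u v)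

-- Subspace configuration: V^(i) = span of the d vectors B i 0, …, B i (d-1).
-- Membership in the sum  Σ_{i ∈ I} V^(i).
InSumOver : {n k d : ℕ} → ℕ → (Fin k → Fin d → Vecp n) → Subset k → Vecp n → Set
InSumOver {n} {k} {d} p B I v =
  Σ (Fin k → Fin d → ℕ) λ c →
    VecEq p (λ t → sumFin k (λ i → if lookup I i then lin d (B i) (c i) t else 0)) v

-- Take d = 2^k blocks of ℓ coordinates, one block for each subset T of [k]. The space V^(i) is
-- spanned by d vectors, one on each block T, namely (x^ℓ, 1, x, …, x^(ℓ−2)) for the node
-- x = 2^i + c_T, where the shift c_T is 0, or −code(T)/ℓ with code(T) = Σ_{t ∈ T} 2^t if T ∈ 𝓘.
-- For ℓ distinct nodes these vectors have determinant (Vandermonde) · Σ x_i, and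
-- Σ_{i ∈ I} x_i = code(I) + ℓ c_T vanishes mod p ≥ 2^k + k + 1 only in the block T = I with I ∈ 𝓘;
-- there the block of V_I is a hyperplane, and every other block is full. Any ℓ + 1 distinct nodes
-- give a full block. Both determinant facts are proved through the moments Σ_{i ∈ I} w_i x_i^r:
-- their first |I| values can be prescribed freely, and when the first N of them vanish on N + 1
-- nodes, the (N+1)-st is Σ x_i times the N-th.

module Submission where

open import Defs
open import Data.Nat using (ℕ; zero; suc; pred; _+_; _*_; _∸_; _^_; _<_; _≤_; z≤n; s≤s; NonZero)
import Data.Nat as ℕ
open import Data.Nat.Properties hiding (_≟_)
open import Data.Nat.DivMod using (_%_; _/_; m≡m%n+[m/n]*n; [m+kn]%n≡m%n; %-distribˡ-+; %-distribˡ-*; m<n⇒m%n≡m)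
open import Data.Nat.Divisibility using (_∣_; divides)
open import Data.Nat.Primality using (Prime; prime⇒irreducible; prime⇒nonZero)
open import Data.Nat.Coprimality using (Coprime; coprime⇒GCD≡1)
open import Data.Nat.GCD using (module GCD; module Bézout)
open Bézout using (result; +-; -+)
open import Data.Nat.Tactic.RingSolver using (solve-∀)
open import Algebra.Properties.CommutativeSemigroup +-commutativeSemigroup
  using (interchange; x∙yz≈y∙xz; xy∙z≈xz∙y; x∙yz≈xz∙y)
import Algebra.Properties.CommutativeSemigroup
open import Data.Fin using (Fin; zero; suc; toℕ; fromℕ<; punchIn; punchOut; combine; remQuot; _≟_)
open import Data.Fin.Properties
  using (toℕ<n; toℕ-fromℕ<; toℕ-injective; punchIn-injective; punchInᵢ≢i; punchIn-punchOut;
         remQuot-combine; combine-remQuot; combine-injectiveˡ)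
import Data.Fin.Properties as Finₚ
open import Data.Fin.Subset using (Subset; ∣_∣; ⁅_⁆; ⊥; _∈_)
open import Data.Fin.Subset.Properties using (∣⊥∣≡0; x∈⁅x⁆; x∈⁅y⁆⇒x≡y)
open import Data.Vec using ([]; _∷_; lookup)
open import Data.Bool using (Bool; true; false; if_then_else_)
open import Data.Product using (Σ; _×_; _,_; proj₁; proj₂; uncurry)
open import Data.Sum using (inj₁; inj₂)
open import Function using (_∘_)
open import Relation.Nullary using (¬_; Dec; does; yes; no; contradiction)
open import Relation.Nullary.Decidable using (dec-true; dec-false)
open import Relation.Binary.Bundles using (Setoid)
open import Relation.Binary.PropositionalEquality

private module *-CS = Algebra.Properties.CommutativeSemigroup *-commutativeSemigroup

sumFin-cong : ∀ n {f g : Fin n → ℕ} → (∀ i → f i ≡ g i) → sumFin n f ≡ sumFin n g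
sumFin-cong zero    f≗g = refl
sumFin-cong (suc n) f≗g = cong₂ _+_ (f≗g zero) (sumFin-cong n (f≗g ∘ suc))

sumFin-zero : ∀ n → sumFin n (λ _ → 0) ≡ 0
sumFin-zero zero    = refl
sumFin-zero (suc n) = sumFin-zero n

sumFin-distrib-+ : ∀ n (f g : Fin n → ℕ) → sumFin n (λ i → f i + g i) ≡ sumFin n f + sumFin n g
sumFin-distrib-+ zero    f g = refl
sumFin-distrib-+ (suc n) f g = begin
  f zero + g zero + sumFin n (λ i → f (suc i) + g (suc i))
    ≡⟨ cong (f zero + g zero +_) (sumFin-distrib-+ n (f ∘ suc) (g ∘ suc)) ⟩
  f zero + g zero + (sumFin n (f ∘ suc) + sumFin n (g ∘ suc))
    ≡⟨ interchange (f zero) (g zero) _ _ ⟩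
  f zero + sumFin n (f ∘ suc) + (g zero + sumFin n (g ∘ suc)) ∎
  where open ≡-Reasoning

*-distribˡ-sumFin : ∀ n c (f : Fin n → ℕ) → c * sumFin n f ≡ sumFin n (λ i → c * f i)
*-distribˡ-sumFin zero    c f = *-zeroʳ c
*-distribˡ-sumFin (suc n) c f =
  trans (*-distribˡ-+ c _ _) (cong (c * f zero +_) (*-distribˡ-sumFin n c (f ∘ suc)))

*-distribʳ-sumFin : ∀ n c (f : Fin n → ℕ) → sumFin n f * c ≡ sumFin n (λ i → f i * c)
*-distribʳ-sumFin n c f =
  trans (*-comm _ c) (trans (*-distribˡ-sumFin n c f) (sumFin-cong n (λ i → *-comm c (f i))))

sumFin-swap : ∀ n m (f : Fin n → Fin m → ℕ) →
  sumFin n (λ i → sumFin m (f i)) ≡ sumFin m (λ j → sumFin n (λ i → f i j))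
sumFin-swap zero    m f = sym (sumFin-zero m)
sumFin-swap (suc n) m f = trans
  (cong (sumFin m (f zero) +_) (sumFin-swap n m (f ∘ suc)))
  (sym (sumFin-distrib-+ m (f zero) (λ j → sumFin n (λ i → f (suc i) j))))

sumFin-punchIn : ∀ n (a : Fin (suc n)) (f : Fin (suc n) → ℕ) →
  sumFin (suc n) f ≡ f a + sumFin n (f ∘ punchIn a)
sumFin-punchIn n       zero    f = refl
sumFin-punchIn (suc n) (suc a) f = trans
  (cong (f zero +_) (sumFin-punchIn n a (f ∘ suc)))
  (x∙yz≈y∙xz (f zero) (f (suc a)) _)

δ : ∀ {n} → Fin n → Fin n → ℕ
δ i j = if does (i ≟ j) then 1 else 0

δ-refl : ∀ {n} (i : Fin n) → δ i i ≡ 1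
δ-refl i rewrite dec-true (i ≟ i) refl = refl

δ-≢ : ∀ {n} {i j : Fin n} → ¬ i ≡ j → δ i j ≡ 0
δ-≢ {i = i} {j} i≢j rewrite dec-false (i ≟ j) i≢j = refl

sumFin-δ : ∀ n (f : Fin n → ℕ) (j : Fin n) → sumFin n (λ i → f i * δ i j) ≡ f j
sumFin-δ (suc n) f zero = begin
  f zero * 1 + sumFin n (λ i → f (suc i) * 0) ≡⟨ cong₂ _+_ (*-identityʳ (f zero)) (sumFin-cong n (λ i → *-zeroʳ (f (suc i)))) ⟩
  f zero + sumFin n (λ _ → 0)                 ≡⟨ cong (f zero +_) (sumFin-zero n) ⟩
  f zero + 0                                  ≡⟨ +-identityʳ (f zero) ⟩
  f zero ∎
  where open ≡-Reasoning
sumFin-δ (suc n) f (suc j) = trans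
  (cong (_+ sumFin n (λ i → f (suc i) * δ i j)) (*-zeroʳ (f zero)))
  (sumFin-δ n (f ∘ suc) j)

δ-injective : ∀ {m n} (f : Fin m → Fin n) → (∀ {i j} → f i ≡ f j → i ≡ j) → ∀ i j → δ (f i) (f j) ≡ δ i j
δ-injective f f-inj i j with i ≟ j
... | yes refl = δ-refl (f i)
... | no i≢j   = δ-≢ (i≢j ∘ f-inj)

prime∤⇒coprime : ∀ {p a} → Prime p → ¬ p ∣ a → Coprime p a
prime∤⇒coprime pr p∤a (d∣p , d∣a) with prime⇒irreducible pr d∣p
... | inj₁ d≡1  = d≡1
... | inj₂ refl = contradiction d∣a p∤a

module Modular (p : ℕ) .{{_ : NonZero p}} where

  infix 4 _≈_
  _≈_ : ℕ → ℕ → Set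
  _≈_ = EqMod p

  ≈⇒%≡ : ∀ {a b} → a ≈ b → a % p ≡ b % p
  ≈⇒%≡ {a} {b} (x , y , eq) = begin
    a % p           ≡⟨ [m+kn]%n≡m%n a x p ⟨
    (a + x * p) % p ≡⟨ cong (_% p) eq ⟩
    (b + y * p) % p ≡⟨ [m+kn]%n≡m%n b y p ⟩
    b % p           ∎
    where open ≡-Reasoning

  %≡⇒≈ : ∀ {a b} → a % p ≡ b % p → a ≈ b
  %≡⇒≈ {a} {b} eq = b / p , a / p , (begin
    a + b / p * p                 ≡⟨ cong (_+ b / p * p) (m≡m%n+[m/n]*n a p) ⟩
    a % p + a / p * p + b / p * p ≡⟨ cong (λ r → r + a / p * p + b / p * p) eq ⟩
    b % p + a / p * p + b / p * p ≡⟨ xy∙z≈xz∙y (b % p) (a / p * p) (b / p * p) ⟩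
    b % p + b / p * p + a / p * p ≡⟨ cong (_+ a / p * p) (m≡m%n+[m/n]*n b p) ⟨
    b + a / p * p                 ∎)
    where open ≡-Reasoning

  ≡⇒≈ : ∀ {a b} → a ≡ b → a ≈ b
  ≡⇒≈ refl = 0 , 0 , refl

  ≈-refl : ∀ {a} → a ≈ a
  ≈-refl = ≡⇒≈ refl

  ≈-sym : ∀ {a b} → a ≈ b → b ≈ a
  ≈-sym (x , y , eq) = y , x , sym eq

  ≈-trans : ∀ {a b c} → a ≈ b → b ≈ c → a ≈ c
  ≈-trans a≈b b≈c = %≡⇒≈ (trans (≈⇒%≡ a≈b) (≈⇒%≡ b≈c))

  ≈-setoid : Setoid _ _
  ≈-setoid = record
    { Carrier = ℕ ; _≈_ = _≈_
    ; isEquivalence = record { refl = ≈-refl ; sym = ≈-sym ; trans = ≈-trans } }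

  +-cong : ∀ {a b c d} → a ≈ b → c ≈ d → a + c ≈ b + d
  +-cong {a} {b} {c} {d} a≈b c≈d = %≡⇒≈ (begin
    (a + c) % p             ≡⟨ %-distribˡ-+ a c p ⟩
    (a % p + c % p) % p     ≡⟨ cong₂ (λ u v → (u + v) % p) (≈⇒%≡ a≈b) (≈⇒%≡ c≈d) ⟩
    (b % p + d % p) % p     ≡⟨ %-distribˡ-+ b d p ⟨
    (b + d) % p             ∎)
    where open ≡-Reasoning

  *-cong : ∀ {a b c d} → a ≈ b → c ≈ d → a * c ≈ b * d
  *-cong {a} {b} {c} {d} a≈b c≈d = %≡⇒≈ (begin
    (a * c) % p             ≡⟨ %-distribˡ-* a c p ⟩
    (a % p * (c % p)) % p   ≡⟨ cong₂ (λ u v → (u * v) % p) (≈⇒%≡ a≈b) (≈⇒%≡ c≈d) ⟩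
    (b % p * (d % p)) % p   ≡⟨ %-distribˡ-* b d p ⟨
    (b * d) % p             ∎)
    where open ≡-Reasoning

  sumFin-cong≈ : ∀ n {f g : Fin n → ℕ} → (∀ i → f i ≈ g i) → sumFin n f ≈ sumFin n g
  sumFin-cong≈ zero    f≈g = ≈-refl
  sumFin-cong≈ (suc n) f≈g = +-cong (f≈g zero) (sumFin-cong≈ n (f≈g ∘ suc))

  *-congˡ : ∀ c {a b} → a ≈ b → c * a ≈ c * b
  *-congˡ c = *-cong (≈-refl {c})

  *-congʳ : ∀ c {a b} → a ≈ b → a * c ≈ b * c
  *-congʳ c a≈b = *-cong a≈b (≈-refl {c})

  ≈⇒≡ : ∀ {a b} → a < p → b < p → a ≈ b → a ≡ b
  ≈⇒≡ {a} {b} a<p b<p a≈b =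
    trans (sym (m<n⇒m%n≡m a<p)) (trans (≈⇒%≡ a≈b) (m<n⇒m%n≡m b<p))

  ∣⇒≈0 : ∀ {a} → p ∣ a → a ≈ 0
  ∣⇒≈0 (divides q refl) = 0 , q , +-identityʳ _

  -- (p − 1) · a represents −a
  neg : ℕ → ℕ
  neg a = pred p * a

  +-inverseʳ : ∀ a → a + neg a ≈ 0
  +-inverseʳ a = 0 , a , (begin
    a + pred p * a + 0 ≡⟨ +-identityʳ _ ⟩
    suc (pred p) * a   ≡⟨ cong (_* a) (suc-pred p) ⟩
    p * a              ≡⟨ *-comm p a ⟩
    a * p              ∎)
    where open ≡-Reasoning

  neg-cancelʳ : ∀ a c → a + c + neg c ≈ a
  neg-cancelʳ a c = ≈-trans (≡⇒≈ (+-assoc a c (neg c)))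
    (≈-trans (+-cong (≈-refl {a}) (+-inverseʳ c)) (≡⇒≈ (+-identityʳ a)))

  +-cancelʳ-≈ : ∀ c {a b} → a + c ≈ b + c → a ≈ b
  +-cancelʳ-≈ c {a} {b} a+c≈b+c =
    ≈-trans (≈-sym (neg-cancelʳ a c)) (≈-trans (+-cong a+c≈b+c ≈-refl) (neg-cancelʳ b c))

  +-neg≈0⇒≈ : ∀ {a b} → a + neg b ≈ 0 → a ≈ b
  +-neg≈0⇒≈ {a} {b} a-b≈0 = +-cancelʳ-≈ (neg b) (≈-trans a-b≈0 (≈-sym (+-inverseʳ b)))

  ≈0⇒+≈ : ∀ {a} b → a ≈ 0 → a + b ≈ b
  ≈0⇒+≈ b a≈0 = +-cong a≈0 (≈-refl {b})

  ≈0⇒*≈0 : ∀ c {a} → a ≈ 0 → c * a ≈ 0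
  ≈0⇒*≈0 c {a} a≈0 = ≈-trans (*-congˡ c a≈0) (≡⇒≈ (*-zeroʳ c))

  -- abstract, since unfolding the Bézout recursion makes type checking very slow
  abstract
    inv : ℕ → ℕ
    inv a with Bézout.lemma p a
    ... | result _ _ (+- _ y _) = neg y
    ... | result _ _ (-+ _ y _) = y

    coprime⇒*-inverseʳ : ∀ {a} → Coprime p a → a * inv a ≈ 1
    coprime⇒*-inverseʳ {a} cop with Bézout.lemma p a
    ... | result _ g (+- x y eq) with refl ← GCD.unique g (coprime⇒GCD≡1 cop) =
        1 , pred p * x , subst (λ q → a * (pred p * y) + 1 * q ≡ 1 + pred p * x * q) (suc-pred p)
          (bézout-neg (pred p) (trans eq (cong (x *_) (sym (suc-pred p)))))
      where
        bézout-neg : ∀ q {x y} → 1 + y * a ≡ x * suc q → a * (q * y) + 1 * suc q ≡ 1 + q * x * suc q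
        bézout-neg q {x} {y} eq = begin
          a * (q * y) + 1 * suc q ≡⟨ rearrange a q y ⟩
          1 + q * (1 + y * a)     ≡⟨ cong (λ r → 1 + q * r) eq ⟩
          1 + q * (x * suc q)     ≡⟨ cong suc (*-assoc q x (suc q)) ⟨
          1 + q * x * suc q       ∎
          where
            open ≡-Reasoning
            rearrange : ∀ a q y → a * (q * y) + 1 * suc q ≡ 1 + q * (1 + y * a)
            rearrange = solve-∀
    ... | result _ g (-+ x y eq) with refl ← GCD.unique g (coprime⇒GCD≡1 cop) =
        0 , x , trans (+-identityʳ _) (trans (*-comm a y) (sym eq))

  *-inverseʳ : ∀ {a} → Prime p → ¬ a ≈ 0 → a * inv a ≈ 1
  *-inverseʳ pr a≉0 = coprime⇒*-inverseʳ (prime∤⇒coprime pr (a≉0 ∘ ∣⇒≈0))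

sumOver : ∀ {k} → Subset k → (Fin k → ℕ) → ℕ
sumOver {k} M f = sumFin k (λ i → if lookup M i then f i else 0)

sumOver-cong : ∀ {k} (M : Subset k) {f g : Fin k → ℕ} →
  (∀ i → lookup M i ≡ true → f i ≡ g i) → sumOver M f ≡ sumOver M g
sumOver-cong []          f≗g = refl
sumOver-cong (true ∷ M)  f≗g = cong₂ _+_ (f≗g zero refl) (sumOver-cong M (f≗g ∘ suc))
sumOver-cong (false ∷ M) f≗g = sumOver-cong M (f≗g ∘ suc)

sumOver-distrib-+ : ∀ {k} (M : Subset k) (f g : Fin k → ℕ) →
  sumOver M (λ i → f i + g i) ≡ sumOver M f + sumOver M g
sumOver-distrib-+ []          f g = refl
sumOver-distrib-+ (true ∷ M)  f g = trans
  (cong (f zero + g zero +_) (sumOver-distrib-+ M (f ∘ suc) (g ∘ suc)))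
  (interchange (f zero) (g zero) _ _)
sumOver-distrib-+ (false ∷ M) f g = sumOver-distrib-+ M (f ∘ suc) (g ∘ suc)

*-distribˡ-sumOver : ∀ {k} (M : Subset k) c (f : Fin k → ℕ) → c * sumOver M f ≡ sumOver M (λ i → c * f i)
*-distribˡ-sumOver []          c f = *-zeroʳ c
*-distribˡ-sumOver (true ∷ M)  c f =
  trans (*-distribˡ-+ c _ _) (cong (c * f zero +_) (*-distribˡ-sumOver M c (f ∘ suc)))
*-distribˡ-sumOver (false ∷ M) c f = *-distribˡ-sumOver M c (f ∘ suc)

*-distribʳ-sumOver : ∀ {k} (M : Subset k) c (f : Fin k → ℕ) → sumOver M f * c ≡ sumOver M (λ i → f i * c)
*-distribʳ-sumOver M c f =
  trans (*-comm _ c) (trans (*-distribˡ-sumOver M c f) (sumOver-cong M (λ i _ → *-comm c (f i))))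

sumOver-empty : ∀ {k} (M : Subset k) (f : Fin k → ℕ) → ∣ M ∣ ≡ 0 → sumOver M f ≡ 0
sumOver-empty []          f _  = refl
sumOver-empty (false ∷ M) f ∣M∣≡0 = sumOver-empty M (f ∘ suc) ∣M∣≡0

sumOver-+-const : ∀ {k} (M : Subset k) (f : Fin k → ℕ) c →
  sumOver M (λ i → f i + c) ≡ sumOver M f + ∣ M ∣ * c
sumOver-+-const []          f c = refl
sumOver-+-const (true ∷ M)  f c = trans
  (cong (f zero + c +_) (sumOver-+-const M (f ∘ suc) c))
  (interchange (f zero) c _ _)
sumOver-+-const (false ∷ M) f c = sumOver-+-const M (f ∘ suc) c

sumOver-sumFin : ∀ {k} (M : Subset k) n (f : Fin n → Fin k → ℕ) →
  sumOver M (λ i → sumFin n (λ r → f r i)) ≡ sumFin n (λ r → sumOver M (f r))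
sumOver-sumFin []          n f = sym (sumFin-zero n)
sumOver-sumFin (true ∷ M)  n f = trans
  (cong (sumFin n (λ r → f r zero) +_) (sumOver-sumFin M n (λ r → f r ∘ suc)))
  (sym (sumFin-distrib-+ n (λ r → f r zero) (λ r → sumOver M (f r ∘ suc))))
sumOver-sumFin (false ∷ M) n f = sumOver-sumFin M n (λ r → f r ∘ suc)

module Moments (p : ℕ) .{{_ : NonZero p}} where

  open Modular p

  sumOver-cong≈ : ∀ {k} (M : Subset k) {f g : Fin k → ℕ} →
    (∀ i → lookup M i ≡ true → f i ≈ g i) → sumOver M f ≈ sumOver M g
  sumOver-cong≈ []          f≈g = ≈-refl
  sumOver-cong≈ (true ∷ M)  f≈g = +-cong (f≈g zero refl) (sumOver-cong≈ M (f≈g ∘ suc))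
  sumOver-cong≈ (false ∷ M) f≈g = sumOver-cong≈ M (f≈g ∘ suc)

  moment : ∀ {k} → Subset k → (x w : Fin k → ℕ) → ℕ → ℕ
  moment M x w r = sumOver M (λ i → w i * x i ^ r)

  Distinct : ∀ {k} → Subset k → (Fin k → ℕ) → Set
  Distinct M x = ∀ i j → lookup M i ≡ true → lookup M j ≡ true → x i ≈ x j → i ≡ j

  distinct-tail : ∀ {k b} (M : Subset k) x → Distinct (b ∷ M) x → Distinct M (x ∘ suc)
  distinct-tail M x dist i j i∈M j∈M xᵢ≈xⱼ = Finₚ.suc-injective (dist (suc i) (suc j) i∈M j∈M xᵢ≈xⱼ)

  distinct-head : ∀ {k} (M : Subset k) x → Distinct (true ∷ M) x →
    ∀ i → lookup M i ≡ true → ¬ x (suc i) + neg (x zero) ≈ 0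
  distinct-head M x dist i i∈M d≈0 with dist (suc i) zero i∈M refl
    (+-cancelʳ-≈ (neg (x zero)) (≈-trans d≈0 (≈-sym (+-inverseʳ (x zero)))))
  ... | ()

  -- multiplying the weights by x_i − x₀ eliminates the pivot node x₀
  -- (the row reduction of a Vandermonde matrix)
  deflate : ∀ {k} (x w : Fin (suc k) → ℕ) → Fin k → ℕ
  deflate x w i = w (suc i) * (x (suc i) + neg (x zero))

  moment-suc : ∀ {k} (M : Subset k) x w r →
    moment (true ∷ M) x w (suc r) ≈ moment M (x ∘ suc) (deflate x w) r + x zero * moment (true ∷ M) x w r
  moment-suc M x w r = ≈-sym (begin
    S + y * (w zero * y ^ r + T)               ≡⟨ cong (S +_) (*-distribˡ-+ y _ T) ⟩
    S + (y * (w zero * y ^ r) + y * T)         ≡⟨ x∙yz≈y∙xz S _ (y * T) ⟩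
    y * (w zero * y ^ r) + (S + y * T)
      ≡⟨ cong₂ _+_ (*-CS.x∙yz≈y∙xz y (w zero) (y ^ r)) (cong (S +_) (*-distribˡ-sumOver M y _)) ⟩
    w zero * y ^ suc r + (S + sumOver M _)     ≡⟨ cong (w zero * y ^ suc r +_) (sym (sumOver-distrib-+ M _ _)) ⟩
    w zero * y ^ suc r + sumOver M _
      ≈⟨ +-cong (≈-refl {w zero * y ^ suc r}) (sumOver-cong≈ M (λ i _ → shift (w (suc i)) (x (suc i)) r)) ⟩
    moment (true ∷ M) x w (suc r)              ∎)
    where
      open import Relation.Binary.Reasoning.Setoid ≈-setoid
      y S T : ℕ
      y = x zero
      S = moment M (x ∘ suc) (deflate x w) r
      T = moment M (x ∘ suc) (w ∘ suc) r
      shift : ∀ w z r → w * (z + neg y) * z ^ r + y * (w * z ^ r) ≈ w * z ^ suc r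
      shift w z r = ≈-trans (≡⇒≈ (regroup w z (neg y) y (z ^ r)))
        (≈-trans (+-cong (≈-refl {w * (z * z ^ r)}) (≈0⇒*≈0 (w * z ^ r) (+-inverseʳ y)))
          (≡⇒≈ (+-identityʳ _)))
        where
          regroup : ∀ a b c d e → a * (b + c) * e + d * (a * e) ≡ a * (b * e) + (a * e) * (d + c)
          regroup = solve-∀

  moment-low⇒moment-suc : ∀ N {k} (M : Subset k) x w → ∣ M ∣ ≡ suc N →
    (∀ r → r < N → moment M x w r ≈ 0) → moment M x w (suc N) ≈ sumOver M x * moment M x w N
  moment-low⇒moment-suc N (false ∷ M) x w ∣M∣ low =
    moment-low⇒moment-suc N M (x ∘ suc) (w ∘ suc) ∣M∣ low
  moment-low⇒moment-suc zero (true ∷ M) x w ∣M∣ low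
    rewrite sumOver-empty M (λ i → w (suc i) * x (suc i) ^ 1) (suc-injective ∣M∣)
          | sumOver-empty M (λ i → w (suc i) * x (suc i) ^ 0) (suc-injective ∣M∣)
          | sumOver-empty M (x ∘ suc) (suc-injective ∣M∣) = ≡⇒≈ (single (w zero) (x zero))
    where
      single : ∀ a b → a * (b * 1) + 0 ≡ (b + 0) * (a * 1 + 0)
      single = solve-∀
  moment-low⇒moment-suc (suc n) (true ∷ M) x w ∣M∣ low = begin
    A (suc (suc n))                 ≈⟨ moment-suc M x w (suc n) ⟩
    U (suc n) + y * A (suc n)       ≈⟨ +-cong IH ≈-refl ⟩
    σ * U n + y * A (suc n)         ≈⟨ +-cong (*-congˡ σ (U≈A n (low n ≤-refl))) ≈-refl ⟩
    σ * A (suc n) + y * A (suc n)   ≡⟨ sym (*-distribʳ-+ (A (suc n)) σ y) ⟩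
    (σ + y) * A (suc n)             ≡⟨ cong (_* A (suc n)) (+-comm σ y) ⟩
    (y + σ) * A (suc n)             ∎
    where
      open import Relation.Binary.Reasoning.Setoid ≈-setoid
      y σ : ℕ
      y = x zero
      σ = sumOver M (x ∘ suc)
      A U : ℕ → ℕ
      A = moment (true ∷ M) x w
      U = moment M (x ∘ suc) (deflate x w)
      U≈A : ∀ r → A r ≈ 0 → U r ≈ A (suc r)
      U≈A r Ar≈0 = ≈-trans (≈-sym (≈-trans (+-cong (≈-refl {U r}) (≈0⇒*≈0 y Ar≈0)) (≡⇒≈ (+-identityʳ (U r)))))
                           (≈-sym (moment-suc M x w r))
      IH : U (suc n) ≈ σ * U n
      IH = moment-low⇒moment-suc n M (x ∘ suc) (deflate x w) (suc-injective ∣M∣)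
             (λ r r<n → ≈-trans (U≈A r (low r (m<n⇒m<1+n r<n))) (low (suc r) (s≤s r<n)))

  moments-surjective : Prime p → ∀ {k} (M : Subset k) x → Distinct M x → (b : ℕ → ℕ) →
    Σ (Fin k → ℕ) λ w → ∀ r → r < ∣ M ∣ → moment M x w r ≈ b r
  moments-surjective pr []          x dist b = (λ ()) , λ _ ()
  moments-surjective pr (false ∷ M) x dist b
    with w , attains ← moments-surjective pr M (x ∘ suc) (distinct-tail M x dist) b =
      (λ { zero → 0 ; (suc i) → w i }) , attains
  moments-surjective pr {suc k} (true ∷ M) x dist b = w , attains
    where
      open import Relation.Binary.Reasoning.Setoid ≈-setoid
      y : ℕ
      y = x zero
      b′ : ℕ → ℕ
      b′ r = b (suc r) + neg (y * b r)
      IH : Σ (Fin k → ℕ) λ u → ∀ r → r < ∣ M ∣ → moment M (x ∘ suc) u r ≈ b′ r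
      IH = moments-surjective pr M (x ∘ suc) (distinct-tail M x dist) b′
      u d : Fin k → ℕ
      u = proj₁ IH
      d i = x (suc i) + neg y
      w : Fin (suc k) → ℕ
      w zero    = b 0 + neg (sumOver M (λ i → u i * inv (d i)))
      w (suc i) = u i * inv (d i)
      deflate≈u : ∀ i → lookup M i ≡ true → deflate x w i ≈ u i
      deflate≈u i i∈M = ≈-trans (≡⇒≈ (*-assoc (u i) (inv (d i)) (d i)))
        (≈-trans (*-congˡ (u i) (≈-trans (≡⇒≈ (*-comm (inv (d i)) (d i))) (*-inverseʳ pr (distinct-head M x dist i i∈M))))
          (≡⇒≈ (*-identityʳ (u i))))
      attains : ∀ r → r < suc ∣ M ∣ → moment (true ∷ M) x w r ≈ b r
      attains zero _ = begin
        w zero * 1 + moment M (x ∘ suc) (w ∘ suc) 0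
          ≡⟨ cong₂ _+_ (*-identityʳ (w zero)) (sumOver-cong M (λ i _ → *-identityʳ (w (suc i)))) ⟩
        b 0 + neg S + S                              ≡⟨ xy∙z≈xz∙y (b 0) (neg S) S ⟩
        b 0 + S + neg S                              ≈⟨ neg-cancelʳ (b 0) S ⟩
        b 0                                          ∎
        where
          S : ℕ
          S = sumOver M (w ∘ suc)
      attains (suc r) (s≤s r<∣M∣) = begin
        moment (true ∷ M) x w (suc r)                              ≈⟨ moment-suc M x w r ⟩
        moment M (x ∘ suc) (deflate x w) r + y * moment (true ∷ M) x w r
          ≈⟨ +-cong (≈-trans (sumOver-cong≈ M (λ i i∈M → *-congʳ (x (suc i) ^ r) (deflate≈u i i∈M))) (proj₂ IH r r<∣M∣))
                    (*-congˡ y (attains r (m<n⇒m<1+n r<∣M∣))) ⟩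
        b (suc r) + neg (y * b r) + y * b r                        ≡⟨ xy∙z≈xz∙y (b (suc r)) _ _ ⟩
        b (suc r) + y * b r + neg (y * b r)                        ≈⟨ neg-cancelʳ (b (suc r)) (y * b r) ⟩
        b (suc r)                                                  ∎

  moment-+-* : ∀ {k} (M : Subset k) x (f g : Fin k → ℕ) c r →
    moment M x (λ i → f i + c * g i) r ≡ moment M x f r + c * moment M x g r
  moment-+-* M x f g c r = trans
    (sumOver-cong M (λ i _ → trans (*-distribʳ-+ (x i ^ r) (f i) (c * g i)) (cong (f i * x i ^ r +_) (*-assoc c (g i) (x i ^ r)))))
    (trans (sumOver-distrib-+ M _ _) (cong (moment M x f r +_) (sym (*-distribˡ-sumOver M c _))))

  moment-sumFin : ∀ {k} (M : Subset k) x n (c : Fin n → ℕ) (g : Fin n → Fin k → ℕ) r →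
    moment M x (λ i → sumFin n (λ j → c j * g j i)) r ≡ sumFin n (λ j → c j * moment M x (g j) r)
  moment-sumFin M x n c g r = begin
    sumOver M (λ i → sumFin n (λ j → c j * g j i) * x i ^ r)   ≡⟨ sumOver-cong M (λ i _ → *-distribʳ-sumFin n (x i ^ r) _) ⟩
    sumOver M (λ i → sumFin n (λ j → c j * g j i * x i ^ r))   ≡⟨ sumOver-sumFin M n (λ j i → c j * g j i * x i ^ r) ⟩
    sumFin n (λ j → sumOver M (λ i → c j * g j i * x i ^ r))   ≡⟨ sumFin-cong n (λ j → sym (trans (*-distribˡ-sumOver M (c j) _)
                                                                    (sumOver-cong M (λ i _ → sym (*-assoc (c j) (g j i) (x i ^ r)))))) ⟩
    sumFin n (λ j → c j * moment M x (g j) r)                   ∎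
    where open ≡-Reasoning

δℕ : ℕ → ℕ → ℕ
δℕ m n = if does (m ℕ.≟ n) then 1 else 0

δℕ-refl : ∀ n → δℕ n n ≡ 1
δℕ-refl n rewrite dec-true (n ℕ.≟ n) refl = refl

δℕ-< : ∀ {m n} → m < n → δℕ m n ≡ 0
δℕ-< {m} {n} m<n rewrite dec-false (m ℕ.≟ n) (<⇒≢ m<n) = refl

δℕ-toℕ : ∀ {n} (i j : Fin n) → δℕ (toℕ i) (toℕ j) ≡ δ i j
δℕ-toℕ i j with i ≟ j
... | yes refl = δℕ-refl (toℕ i)
... | no i≢j   rewrite dec-false (toℕ i ℕ.≟ toℕ j) (i≢j ∘ toℕ-injective) = refl

pad : ∀ {n} → (Fin n → ℕ) → ℕ → ℕ
pad {zero}  z i       = 0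
pad {suc n} z zero    = z zero
pad {suc n} z (suc i) = pad (z ∘ suc) i

pad-toℕ : ∀ {n} (z : Fin n → ℕ) r → pad z (toℕ r) ≡ z r
pad-toℕ z zero    = refl
pad-toℕ z (suc r) = pad-toℕ (z ∘ suc) r

pad-≥ : ∀ {n} (z : Fin n → ℕ) {i} → n ≤ i → pad z i ≡ 0
pad-≥ {zero}  z         n≤i       = refl
pad-≥ {suc n} z {suc i} (s≤s n≤i) = pad-≥ (z ∘ suc) n≤i

Fin-∀ : ∀ {n} {P : ℕ → Set} → (∀ (r : Fin n) → P (toℕ r)) → ∀ r → r < n → P r
Fin-∀ {P = P} h r r<n = subst P (toℕ-fromℕ< r<n) (h (fromℕ< r<n))

-- Within a block, the coordinates of a node x are x^(exponent r):
-- the powers x^ℓ, x^0, …, x^(ℓ−2), skipping x^(ℓ−1).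
exponent : ∀ m → Fin (2 + m) → ℕ
exponent m zero    = 2 + m
exponent m (suc r) = toℕ r

target : ∀ {m} → (Fin (2 + m) → ℕ) → ℕ → ℕ
target {m} z n = pad (z ∘ suc) n + z zero * δℕ n (2 + m)

target-exponent : ∀ {m} (z : Fin (2 + m) → ℕ) r → target z (exponent m r) ≡ z r
target-exponent {m} z zero rewrite pad-≥ (z ∘ suc) (n≤1+n (suc m)) | δℕ-refl (2 + m) = *-identityʳ (z zero)
target-exponent {m} z (suc r)
  rewrite pad-toℕ (z ∘ suc) r | δℕ-< (m<n⇒m<1+n (toℕ<n r)) = trans (cong (z (suc r) +_) (*-zeroʳ (z zero))) (+-identityʳ _)

module Block (p : ℕ) .{{_ : NonZero p}} (pr : Prime p) (m : ℕ) where

  open Modular p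
  open Moments p
  open import Relation.Binary.Reasoning.Setoid ≈-setoid

  Attains : ∀ {k} → Subset k → (Fin k → ℕ) → (Fin (2 + m) → ℕ) → Set
  Attains {k} M x z = Σ (Fin k → ℕ) λ w → ∀ r → moment M x w (exponent m r) ≈ z r

  exponent≤ : ∀ r → exponent m r ≤ 2 + m
  exponent≤ zero    = ≤-refl
  exponent≤ (suc r) = ≤-trans (<⇒≤ (toℕ<n r)) (n≤1+n (suc m))

  attains-of-size-ℓ+1 : ∀ {k} (M : Subset k) x → ∣ M ∣ ≡ 3 + m → Distinct M x → ∀ z → Attains M x z
  attains-of-size-ℓ+1 M x ∣M∣ dist z with w , ok ← moments-surjective pr M x dist (target z) =
    w , λ r → ≈-trans (ok (exponent m r) (<-≤-trans (s≤s (exponent≤ r)) (≤-reflexive (sym ∣M∣))))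
                      (≡⇒≈ (target-exponent z r))

  weights-lifting-top : ∀ {k} (M : Subset k) x → ∣ M ∣ ≡ 2 + m → Distinct M x →
    Σ (Fin k → ℕ) λ w → (∀ r → r < suc m → moment M x w r ≈ 0) × moment M x w (2 + m) ≈ sumOver M x
  weights-lifting-top M x ∣M∣ dist with w , ok ← moments-surjective pr M x dist (λ n → δℕ n (suc m)) =
    w , low , (begin
      moment M x w (2 + m)                  ≈⟨ moment-low⇒moment-suc (suc m) M x w ∣M∣ low ⟩
      sumOver M x * moment M x w (suc m)    ≈⟨ *-congˡ (sumOver M x) (ok (suc m) (<-≤-trans ≤-refl (≤-reflexive (sym ∣M∣)))) ⟩
      sumOver M x * δℕ (suc m) (suc m)      ≡⟨ cong (sumOver M x *_) (δℕ-refl (suc m)) ⟩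
      sumOver M x * 1                       ≡⟨ *-identityʳ (sumOver M x) ⟩
      sumOver M x                           ∎)
    where
      low : ∀ r → r < suc m → moment M x w r ≈ 0
      low r r<1+m = ≈-trans (ok r (<-≤-trans (m<n⇒m<1+n r<1+m) (≤-reflexive (sym ∣M∣)))) (≡⇒≈ (δℕ-< r<1+m))

  attains-of-sum≉0 : ∀ {k} (M : Subset k) x → ∣ M ∣ ≡ 2 + m → Distinct M x → ¬ sumOver M x ≈ 0 →
    ∀ z → Attains M x z
  attains-of-sum≉0 {k} M x ∣M∣ dist σ≉0 z = w , attains
    where
      S₀ : Σ (Fin k → ℕ) λ w₀ → ∀ n → n < ∣ M ∣ → moment M x w₀ n ≈ target z n
      S₀ = moments-surjective pr M x dist (target z)
      S₁ : Σ (Fin k → ℕ) λ w₁ → (∀ r → r < suc m → moment M x w₁ r ≈ 0) × moment M x w₁ (2 + m) ≈ sumOver M x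
      S₁ = weights-lifting-top M x ∣M∣ dist
      w₀ w₁ : Fin k → ℕ
      w₀ = proj₁ S₀
      w₁ = proj₁ S₁
      σ a c : ℕ
      σ = sumOver M x
      a = moment M x w₀ (2 + m)
      c = (z zero + neg a) * inv σ
      w : Fin k → ℕ
      w i = w₀ i + c * w₁ i
      attains : ∀ r → moment M x w (exponent m r) ≈ z r
      attains zero = begin
        moment M x w (2 + m)                     ≡⟨ moment-+-* M x w₀ w₁ c (2 + m) ⟩
        a + c * moment M x w₁ (2 + m)            ≈⟨ +-cong (≈-refl {a}) (*-congˡ c (proj₂ (proj₂ S₁))) ⟩
        a + (z zero + neg a) * inv σ * σ         ≡⟨ cong (a +_) (*-assoc (z zero + neg a) (inv σ) σ) ⟩
        a + (z zero + neg a) * (inv σ * σ)       ≈⟨ +-cong (≈-refl {a}) (*-congˡ (z zero + neg a)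
                                                      (≈-trans (≡⇒≈ (*-comm (inv σ) σ)) (*-inverseʳ pr σ≉0))) ⟩
        a + (z zero + neg a) * 1                 ≡⟨ cong (a +_) (*-identityʳ (z zero + neg a)) ⟩
        a + (z zero + neg a)                     ≡⟨ x∙yz≈xz∙y a (z zero) (neg a) ⟩
        a + neg a + z zero                       ≈⟨ ≈0⇒+≈ (z zero) (+-inverseʳ a) ⟩
        z zero                                   ∎
      attains (suc r) = begin
        moment M x w (toℕ r)                             ≡⟨ moment-+-* M x w₀ w₁ c (toℕ r) ⟩
        moment M x w₀ (toℕ r) + c * moment M x w₁ (toℕ r)
          ≈⟨ +-cong (proj₂ S₀ (toℕ r) (<-≤-trans (m<n⇒m<1+n (toℕ<n r)) (≤-reflexive (sym ∣M∣))))
                    (≈0⇒*≈0 c (proj₁ (proj₂ S₁) (toℕ r) (toℕ<n r))) ⟩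
        target z (exponent m (suc r)) + 0                ≡⟨ trans (+-identityʳ _) (target-exponent z (suc r)) ⟩
        z (suc r)                                        ∎

  module Degenerate {k} (M : Subset k) (x : Fin k → ℕ) (∣M∣ : ∣ M ∣ ≡ 2 + m) (dist : Distinct M x)
                    (σ≈0 : sumOver M x ≈ 0) where

    dual : ∀ r → Σ (Fin k → ℕ) λ w → ∀ n → n < ∣ M ∣ → moment M x w n ≈ δℕ (toℕ {suc m} r) n
    dual r = moments-surjective pr M x dist (δℕ (toℕ r))

    W : Fin (suc m) → Fin k → ℕ
    W r = proj₁ (dual r)

    μ : Fin (suc m) → ℕ
    μ r = moment M x (W r) (2 + m)

    moment-W : ∀ r r′ → moment M x (W r) (toℕ r′) ≈ δ r r′
    moment-W r r′ = ≈-trans (proj₂ (dual r) (toℕ r′) (<-≤-trans (m<n⇒m<1+n (toℕ<n r′)) (≤-reflexive (sym ∣M∣))))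
                            (≡⇒≈ (δℕ-toℕ r r′))

    moment-combination : ∀ c r′ → moment M x (λ i → sumFin (suc m) (λ r → c r * W r i)) (toℕ r′) ≈ c r′
    moment-combination c r′ = ≈-trans (≡⇒≈ (moment-sumFin M x (suc m) c W (toℕ r′)))
      (≈-trans (sumFin-cong≈ (suc m) (λ r → *-congˡ (c r) (moment-W r r′)))
               (≡⇒≈ (sumFin-δ (suc m) c r′)))

    moment-top : ∀ w → moment M x w (2 + m) ≈ sumFin (suc m) (λ r → moment M x w (toℕ r) * μ r)
    moment-top w = ≈-trans (+-neg≈0⇒≈ ν-top≈0) (≡⇒≈ (moment-sumFin M x (suc m) c W (2 + m)))
      where
        c : Fin (suc m) → ℕ
        c r = moment M x w (toℕ r)
        w′ : Fin k → ℕ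
        w′ i = sumFin (suc m) (λ r → c r * W r i)
        ν : Fin k → ℕ
        ν i = w i + neg (w′ i)
        ν-low : ∀ r → moment M x ν (toℕ r) ≈ 0
        ν-low r = ≈-trans (≡⇒≈ (moment-+-* M x w w′ (pred p) (toℕ r)))
          (≈-trans (+-cong (≈-refl {c r}) (*-congˡ (pred p) (moment-combination c r))) (+-inverseʳ (c r)))
        ν-top≈0 : moment M x w (2 + m) + neg (moment M x w′ (2 + m)) ≈ 0
        ν-top≈0 = begin
          moment M x w (2 + m) + neg (moment M x w′ (2 + m)) ≡⟨ moment-+-* M x w w′ (pred p) (2 + m) ⟨
          moment M x ν (2 + m)                                ≈⟨ moment-low⇒moment-suc (suc m) M x ν ∣M∣ (Fin-∀ ν-low) ⟩
          sumOver M x * moment M x ν (suc m)                  ≈⟨ *-congʳ (moment M x ν (suc m)) σ≈0 ⟩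
          0                                                   ∎

    attains-on-hyperplane : ∀ z → z zero ≈ sumFin (suc m) (λ r → z (suc r) * μ r) → Attains M x z
    attains-on-hyperplane z z₀≈ = w , attains
      where
        w : Fin k → ℕ
        w i = sumFin (suc m) (λ r → z (suc r) * W r i)
        attains : ∀ r → moment M x w (exponent m r) ≈ z r
        attains zero    = ≈-trans (≡⇒≈ (moment-sumFin M x (suc m) (z ∘ suc) W (2 + m))) (≈-sym z₀≈)
        attains (suc r) = moment-combination (z ∘ suc) r

module Dimension (p : ℕ) .{{_ : NonZero p}} where

  open Modular p

  unit : ∀ {N} → Fin N → Vecp N
  unit = δ

  lin-unit : ∀ N (c : Fin N → ℕ) t → lin N unit c t ≡ c t
  lin-unit N c t = sumFin-δ N c t

  hasDim-full : ∀ {N} (S : Vecp N → Set) → (∀ v → S v) → HasDim p S N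
  hasDim-full {N} S S-all =
    unit , S-all ∘ unit ,
    (λ c lin≈0 i → ≈-trans (≡⇒≈ (sym (lin-unit N c i))) (lin≈0 i)) ,
    (λ v _ → v , λ t → ≡⇒≈ (lin-unit N v t))

  hasDim-hyperplane : ∀ {N} (S : Vecp N → Set) (s : Fin N) (μ : Fin N → ℕ) → μ s ≡ 0 →
    (∀ a → ¬ a ≡ s → S (λ t → unit a t + μ a * unit s t)) →
    (∀ v → S v → v s ≈ sumFin N (λ a → v a * μ a)) →
    HasDim p S (N ∸ 1)
  hasDim-hyperplane {suc n} S s μ μs≡0 S-basis S-eq = u , S-basis _ ∘ punchInᵢ≢i s , independent , spans
    where
      u : Fin n → Vecp (suc n)
      u b t = unit (punchIn s b) t + μ (punchIn s b) * unit s t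
      s≢punchIn : ∀ b → ¬ s ≡ punchIn s b
      s≢punchIn b = punchInᵢ≢i s b ∘ sym
      u-punchIn : ∀ b b′ → u b (punchIn s b′) ≡ δ b b′
      u-punchIn b b′ = begin
        δ (punchIn s b) (punchIn s b′) + μ (punchIn s b) * δ s (punchIn s b′)
          ≡⟨ cong₂ (λ d e → d + μ (punchIn s b) * e)
                   (δ-injective (punchIn s) (punchIn-injective s _ _) b b′) (δ-≢ (s≢punchIn b′)) ⟩
        δ b b′ + μ (punchIn s b) * 0     ≡⟨ cong (δ b b′ +_) (*-zeroʳ (μ (punchIn s b))) ⟩
        δ b b′ + 0                       ≡⟨ +-identityʳ (δ b b′) ⟩
        δ b b′                           ∎
        where open ≡-Reasoning
      u-s : ∀ b → u b s ≡ μ (punchIn s b)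
      u-s b rewrite δ-≢ (punchInᵢ≢i s b) | δ-refl s = *-identityʳ (μ (punchIn s b))
      lin-u-punchIn : ∀ c b′ → lin n u c (punchIn s b′) ≡ c b′
      lin-u-punchIn c b′ = trans (sumFin-cong n (λ b → cong (c b *_) (u-punchIn b b′))) (sumFin-δ n c b′)
      independent : LinIndep p n u
      independent c lin≈0 b = ≈-trans (≡⇒≈ (sym (lin-u-punchIn c b))) (lin≈0 (punchIn s b))
      spans : ∀ v → S v → InSpan p n u v
      spans v Sv = v ∘ punchIn s , λ t → agrees (s ≟ t)
        where
          agrees : ∀ {t} → Dec (s ≡ t) → lin n u (v ∘ punchIn s) t ≈ v t
          agrees (no s≢t)   = subst (λ t → lin n u (v ∘ punchIn s) t ≈ v t) (punchIn-punchOut s≢t)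
                                (≡⇒≈ (lin-u-punchIn (v ∘ punchIn s) (punchOut s≢t)))
          agrees (yes refl) = ≈-sym (≈-trans (S-eq v Sv) (≡⇒≈ (begin
            sumFin (suc n) (λ a → v a * μ a)                                ≡⟨ sumFin-punchIn n s (λ a → v a * μ a) ⟩
            v s * μ s + sumFin n (λ b → v (punchIn s b) * μ (punchIn s b))
              ≡⟨ cong₂ _+_ (trans (cong (v s *_) μs≡0) (*-zeroʳ (v s)))
                           (sumFin-cong n (λ b → cong (v (punchIn s b) *_) (sym (u-s b)))) ⟩
            lin n u (v ∘ punchIn s) s                                        ∎)))
            where open ≡-Reasoning

bit : Bool → ℕ
bit false = 0
bit true  = 1

code : ∀ {k} → Subset k → ℕ
code []      = 0
code (b ∷ I) = bit b + code I * 2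

odd : ℕ → Bool
odd zero          = false
odd (suc zero)    = true
odd (suc (suc n)) = odd n

half : ℕ → ℕ
half zero          = 0
half (suc zero)    = 0
half (suc (suc n)) = suc (half n)

decode : ∀ k → ℕ → Subset k
decode zero    n = []
decode (suc k) n = odd n ∷ decode k (half n)

odd-bit : ∀ b a → odd (bit b + a * 2) ≡ b
odd-bit false zero    = refl
odd-bit true  zero    = refl
odd-bit false (suc a) = odd-bit false a
odd-bit true  (suc a) = odd-bit true a

half-bit : ∀ b a → half (bit b + a * 2) ≡ a
half-bit false zero    = refl
half-bit true  zero    = refl
half-bit false (suc a) = cong suc (half-bit false a)
half-bit true  (suc a) = cong suc (half-bit true a)

bit-odd-half : ∀ n → bit (odd n) + half n * 2 ≡ n
bit-odd-half zero          = refl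
bit-odd-half (suc zero)    = refl
bit-odd-half (suc (suc n)) = trans (+-suc (bit (odd n)) _)
  (trans (cong suc (+-suc (bit (odd n)) _)) (cong (λ m → suc (suc m)) (bit-odd-half n)))

decode-code : ∀ {k} (I : Subset k) → decode k (code I) ≡ I
decode-code []      = refl
decode-code (b ∷ I) = cong₂ _∷_ (odd-bit b (code I)) (trans (cong (decode _) (half-bit b (code I))) (decode-code I))

code-injective : ∀ {k} {I J : Subset k} → code I ≡ code J → I ≡ J
code-injective {I = I} {J} eq = trans (sym (decode-code I)) (trans (cong (decode _) eq) (decode-code J))

code< : ∀ {k} (I : Subset k) → code I < 2 ^ k
code< []          = s≤s z≤n
code< {suc k} (false ∷ I) = subst (code I * 2 <_) (*-comm (2 ^ k) 2) (*-monoˡ-< 2 (code< I))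
code< {suc k} (true ∷ I)  = subst (suc (code I * 2) <_) (*-comm (2 ^ k) 2) (*-monoˡ-≤ 2 (code< I))

code-decode : ∀ k n → n < 2 ^ k → code (decode k n) ≡ n
code-decode zero    zero    _ = refl
code-decode zero    (suc n) (s≤s ())
code-decode (suc k) n n<2^k+1 = trans (cong (λ c → bit (odd n) + c * 2) (code-decode k (half n) half<)) (bit-odd-half n)
  where
    half< : half n < 2 ^ k
    half< = *-cancelʳ-< 2 (half n) (2 ^ k) (begin-strict
      half n * 2                ≤⟨ m≤n+m (half n * 2) (bit (odd n)) ⟩
      bit (odd n) + half n * 2  ≡⟨ bit-odd-half n ⟩
      n                         <⟨ n<2^k+1 ⟩
      2 * 2 ^ k                 ≡⟨ *-comm 2 (2 ^ k) ⟩
      2 ^ k * 2                 ∎)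
      where open ≤-Reasoning

code-⊥ : ∀ k → code (⊥ {k}) ≡ 0
code-⊥ zero    = refl
code-⊥ (suc k) = cong (_* 2) (code-⊥ k)

sumOver-code⁅⁆ : ∀ {k} (I : Subset k) → sumOver I (λ i → code ⁅ i ⁆) ≡ code I
sumOver-code⁅⁆ []      = refl
sumOver-code⁅⁆ {suc k} (b ∷ I) = cong₂ _+_ (head b)
  (trans (sym (*-distribʳ-sumOver I 2 (λ i → code ⁅ i ⁆))) (cong (_* 2) (sumOver-code⁅⁆ I)))
  where
    head : ∀ b → (if b then code ⁅ zero {k} ⁆ else 0) ≡ bit b
    head false = refl
    head true  = cong (λ c → suc (c * 2)) (code-⊥ k)

⁅⁆-injective : ∀ {k} {i j : Fin k} → ⁅ i ⁆ ≡ ⁅ j ⁆ → i ≡ j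
⁅⁆-injective {i = i} {j} eq = x∈⁅y⁆⇒x≡y j (subst (i ∈_) eq (x∈⁅x⁆ i))

module Construction (k m p : ℕ) .{{_ : NonZero p}} (pr : Prime p) (2^k+k<p : 2 ^ k + k < p)
                    (ℓ<k : 2 + m < k) (𝓘 : Subset k → Bool) where

  open Modular p
  open Moments p
  open Block p pr m
  open Dimension p

  ℓ d : ℕ
  ℓ = 2 + m
  d = 2 ^ k

  -- the blocks of coordinates are indexed by the subsets of [k], via their binary codes
  subset : Fin d → Subset k
  subset t = decode k (toℕ t)

  block : Subset k → Fin d
  block I = fromℕ< (code< I)

  subset-block : ∀ I → subset (block I) ≡ I
  subset-block I = trans (cong (decode k) (toℕ-fromℕ< (code< I))) (decode-code I)

  block-subset : ∀ t → block (subset t) ≡ t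
  block-subset t = toℕ-injective (trans (toℕ-fromℕ< (code< (subset t))) (code-decode k (toℕ t) (toℕ<n t)))

  2^k<p : 2 ^ k < p
  2^k<p = ≤-<-trans (m≤m+n (2 ^ k) k) 2^k+k<p

  ℓ≉0 : ¬ ℓ ≈ 0
  ℓ≉0 ℓ≈0 with ≈⇒≡ (<-trans ℓ<k (≤-<-trans (m≤n+m k (2 ^ k)) 2^k+k<p)) (≤-<-trans z≤n 2^k<p) ℓ≈0
  ... | ()

  code≈⇒≡ : ∀ {I J : Subset k} → code I ≈ code J → I ≡ J
  code≈⇒≡ {I} {J} eq = code-injective (≈⇒≡ (<-trans (code< I) 2^k<p) (<-trans (code< J) 2^k<p) eq)

  -- the shift −code(S)/ℓ moves the node sum of S, and of no other ℓ-set, to 0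
  shift : Subset k → ℕ
  shift S = neg (code S) * inv ℓ

  code+ℓ*shift≈0 : ∀ S → code S + ℓ * shift S ≈ 0
  code+ℓ*shift≈0 S = ≈-trans (+-cong (≈-refl {code S}) ℓ*shift≈) (+-inverseʳ (code S))
    where
      ℓ*shift≈ : ℓ * shift S ≈ neg (code S)
      ℓ*shift≈ = ≈-trans (≡⇒≈ (*-CS.x∙yz≈y∙xz ℓ (neg (code S)) (inv ℓ)))
        (≈-trans (*-congˡ (neg (code S)) (*-inverseʳ pr ℓ≉0)) (≡⇒≈ (*-identityʳ (neg (code S)))))

  offset : Fin d → ℕ
  offset t = if 𝓘 (subset t) then shift (subset t) else 0

  X : Fin d → Fin k → ℕ
  X t i = code ⁅ i ⁆ + offset t

  distinct : ∀ t I → Distinct I (X t)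
  distinct t I i j _ _ Xi≈Xj = ⁅⁆-injective (code≈⇒≡ (+-cancelʳ-≈ (offset t) Xi≈Xj))

  sumOver-X : ∀ t I → sumOver I (X t) ≡ code I + ∣ I ∣ * offset t
  sumOver-X t I = trans (sumOver-+-const I (λ i → code ⁅ i ⁆) (offset t)) (cong (_+ ∣ I ∣ * offset t) (sumOver-code⁅⁆ I))

  sumOver-X≈0 : ∀ I → ∣ I ∣ ≡ ℓ → 𝓘 I ≡ true → sumOver I (X (block I)) ≈ 0
  sumOver-X≈0 I ∣I∣ I∈𝓘 = ≈-trans (≡⇒≈ (trans (sumOver-X (block I) I) (cong₂ (λ n o → code I + n * o) ∣I∣ offset≡)))
                                   (code+ℓ*shift≈0 I)
    where
      offset≡ : offset (block I) ≡ shift I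
      offset≡ rewrite subset-block I | I∈𝓘 = refl

  sumOver-X≈0⇒block : ∀ I t → ∣ I ∣ ≡ ℓ → sumOver I (X t) ≈ 0 → 𝓘 I ≡ true × t ≡ block I
  sumOver-X≈0⇒block I t ∣I∣ σ≈0 = by-cases (𝓘 S) refl
    where
      S : Subset k
      S = subset t
      σ≡ : ∀ {b} → 𝓘 S ≡ b → sumOver I (X t) ≡ code I + ℓ * (if b then shift S else 0)
      σ≡ S∈𝓘 = trans (sumOver-X t I) (cong₂ (λ n o → code I + n * o) ∣I∣ (cong (λ b → if b then shift S else 0) S∈𝓘))
      by-cases : ∀ b → 𝓘 S ≡ b → 𝓘 I ≡ true × t ≡ block I
      by-cases true S∈𝓘 = subst (λ S → 𝓘 S ≡ true) S≡I S∈𝓘 , trans (sym (block-subset t)) (cong block S≡I)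
        where
          S≡I : S ≡ I
          S≡I = code≈⇒≡ (+-cancelʳ-≈ (ℓ * shift S)
                  (≈-trans (code+ℓ*shift≈0 S) (≈-sym (≈-trans (≡⇒≈ (sym (σ≡ S∈𝓘))) σ≈0))))
      by-cases false S∉𝓘 = contradiction (trans (sym ∣I∣) (trans (cong ∣_∣ I≡⊥) (∣⊥∣≡0 k))) λ ()
        where
          code≈0 : code I ≈ 0
          code≈0 = ≈-trans
            (≡⇒≈ (sym (trans (σ≡ S∉𝓘) (trans (cong (code I +_) (*-zeroʳ ℓ)) (+-identityʳ (code I)))))) σ≈0
          I≡⊥ : I ≡ ⊥
          I≡⊥ = code≈⇒≡ (≈-trans code≈0 (≡⇒≈ (sym (code-⊥ k))))

  -- the coordinates Fin (ℓ * d) are the pairs (r , t) of a row r and a block t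
  entry : Fin k → Fin d → Fin ℓ → Fin d → ℕ
  entry i t r t′ = X t i ^ exponent m r * δ t t′

  B : Fin k → Fin d → Vecp (ℓ * d)
  B i t = uncurry (entry i t) ∘ remQuot d

  lin-B : ∀ i c r t → lin d (B i) c (combine r t) ≡ c t * X t i ^ exponent m r
  lin-B i c r t = trans
    (sumFin-cong d (λ t′ → trans (cong (λ a → c t′ * uncurry (entry i t′) a) (remQuot-combine r t))
                                 (sym (*-assoc (c t′) _ (δ t′ t)))))
    (sumFin-δ d (λ t′ → c t′ * X t′ i ^ exponent m r) t)

  linIndep-B : ∀ i → LinIndep p d (B i)
  linIndep-B i c lin≈0 t =
    ≈-trans (≡⇒≈ (sym (trans (lin-B i c (suc zero) t) (*-identityʳ (c t))))) (lin≈0 (combine {ℓ} (suc zero) t))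

  sum-B : (I : Subset k) → (Fin k → Fin d → ℕ) → Vecp (ℓ * d)
  sum-B I c a = sumOver I (λ i → lin d (B i) (c i) a)

  sum-B-combine : ∀ I c r t → sum-B I c (combine r t) ≡ moment I (X t) (λ i → c i t) (exponent m r)
  sum-B-combine I c r t = sumOver-cong I (λ i _ → lin-B i (c i) r t)

  inSum-of-blocks : ∀ I v → (∀ t → Attains I (X t) (λ r → v (combine r t))) → InSumOver p B I v
  inSum-of-blocks I v attains = c , λ a → subst (λ a → sum-B I c a ≈ v a) (combine-remQuot d a) (at (remQuot d a))
    where
      c : Fin k → Fin d → ℕ
      c i t = proj₁ (attains t) i
      at : ∀ rt → sum-B I c (uncurry combine rt) ≈ v (uncurry combine rt)
      at (r , t) = ≈-trans (≡⇒≈ (sum-B-combine I c r t)) (proj₂ (attains t) r)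

  hasDim-of-blocks : ∀ I → (∀ t z → Attains I (X t) z) → HasDim p (InSumOver p B I) (ℓ * d)
  hasDim-of-blocks I attains = hasDim-full (InSumOver p B I) (λ v → inSum-of-blocks I v (λ t → attains t _))

  hasDim-generic : ∀ I → ∣ I ∣ ≡ ℓ → 𝓘 I ≡ false → HasDim p (InSumOver p B I) (ℓ * d)
  hasDim-generic I ∣I∣ I∉𝓘 = hasDim-of-blocks I λ t → attains-of-sum≉0 I (X t) ∣I∣ (distinct t I)
    λ σ≈0 → contradiction (trans (sym I∉𝓘) (proj₁ (sumOver-X≈0⇒block I t ∣I∣ σ≈0))) λ ()

  hasDim-large : ∀ I → ∣ I ∣ ≡ suc ℓ → HasDim p (InSumOver p B I) (ℓ * d)
  hasDim-large I ∣I∣ = hasDim-of-blocks I λ t → attains-of-size-ℓ+1 I (X t) ∣I∣ (distinct t I)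

  module DegenerateSet (I : Subset k) (∣I∣ : ∣ I ∣ ≡ ℓ) (I∈𝓘 : 𝓘 I ≡ true) where

    t₀ : Fin d
    t₀ = block I

    open Degenerate I (X t₀) ∣I∣ (distinct t₀ I) (sumOver-X≈0 I ∣I∣ I∈𝓘)

    s : Fin (ℓ * d)
    s = combine {ℓ} zero t₀

    above : Fin (suc m) → Fin (ℓ * d)
    above r = combine {ℓ} (suc r) t₀

    δ-s-above : ∀ r → δ s (above r) ≡ 0
    δ-s-above r = δ-≢ ((λ ()) ∘ combine-injectiveˡ {ℓ} zero t₀ (suc r) t₀)

    -- the normal vector of the hyperplane: v lies in it iff v s ≈ Σ_r μ r · v (above r)
    φ : Fin (ℓ * d) → ℕ
    φ a = sumFin (suc m) (λ r → δ a (above r) * μ r)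

    φ-s : φ s ≡ 0
    φ-s = trans (sumFin-cong (suc m) (λ r → cong (_* μ r) (δ-s-above r))) (sumFin-zero (suc m))

    sum-φ : ∀ v → sumFin (ℓ * d) (λ a → v a * φ a) ≡ sumFin (suc m) (λ r → v (above r) * μ r)
    sum-φ v = begin
      sumFin (ℓ * d) (λ a → v a * φ a)
        ≡⟨ sumFin-cong (ℓ * d) (λ a → *-distribˡ-sumFin (suc m) (v a) (λ r → δ a (above r) * μ r)) ⟩
      sumFin (ℓ * d) (λ a → sumFin (suc m) (λ r → v a * (δ a (above r) * μ r)))
        ≡⟨ sumFin-swap (ℓ * d) (suc m) (λ a r → v a * (δ a (above r) * μ r)) ⟩
      sumFin (suc m) (λ r → sumFin (ℓ * d) (λ a → v a * (δ a (above r) * μ r)))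
        ≡⟨ sumFin-cong (suc m) (λ r → trans (sumFin-cong (ℓ * d) (λ a → sym (*-assoc (v a) (δ a (above r)) (μ r))))
                                             (sym (*-distribʳ-sumFin (ℓ * d) (μ r) (λ a → v a * δ a (above r))))) ⟩
      sumFin (suc m) (λ r → sumFin (ℓ * d) (λ a → v a * δ a (above r)) * μ r)
        ≡⟨ sumFin-cong (suc m) (λ r → cong (_* μ r) (sumFin-δ (ℓ * d) v (above r))) ⟩
      sumFin (suc m) (λ r → v (above r) * μ r) ∎
      where open ≡-Reasoning

    equation : ∀ v → InSumOver p B I v → v s ≈ sumFin (ℓ * d) (λ a → v a * φ a)
    equation v (c , c↦v) = begin
      v s                                                              ≈⟨ ≈-sym (c↦v s) ⟩
      sum-B I c s                                                      ≡⟨ sum-B-combine I c zero t₀ ⟩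
      moment I (X t₀) ω ℓ                                              ≈⟨ moment-top ω ⟩
      sumFin (suc m) (λ r → moment I (X t₀) ω (toℕ r) * μ r)           ≈⟨ sumFin-cong≈ (suc m) (λ r → *-congʳ (μ r) (row r)) ⟩
      sumFin (suc m) (λ r → v (above r) * μ r)                          ≡⟨ sum-φ v ⟨
      sumFin (ℓ * d) (λ a → v a * φ a)                                 ∎
      where
        open import Relation.Binary.Reasoning.Setoid ≈-setoid
        ω : Fin k → ℕ
        ω i = c i t₀
        row : ∀ r → moment I (X t₀) ω (toℕ r) ≈ v (above r)
        row r = ≈-trans (≡⇒≈ (sym (sum-B-combine I c (suc r) t₀))) (c↦v (above r))

    spanning : ∀ a → ¬ a ≡ s → InSumOver p B I (λ b → unit a b + φ a * unit s b)
    spanning a a≢s = inSum-of-blocks I v (λ t → attains-by (t ≟ t₀))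
      where
        v : Vecp (ℓ * d)
        v b = unit a b + φ a * unit s b
        v-s : v s ≡ φ a
        v-s = trans (cong₂ (λ x y → x + φ a * y) (δ-≢ a≢s) (δ-refl s)) (*-identityʳ (φ a))
        v-above : ∀ r → v (above r) ≡ δ a (above r)
        v-above r = trans (cong (λ y → δ a (above r) + φ a * y) (δ-s-above r))
                          (trans (cong (δ a (above r) +_) (*-zeroʳ (φ a))) (+-identityʳ _))
        attains-by : ∀ {t} → Dec (t ≡ t₀) → Attains I (X t) (λ r → v (combine r t))
        attains-by (yes refl) = attains-on-hyperplane _
          (≡⇒≈ (trans v-s (sumFin-cong (suc m) (λ r → cong (_* μ r) (sym (v-above r))))))
        attains-by {t} (no t≢t₀) =
          attains-of-sum≉0 I (X t) ∣I∣ (distinct t I) (t≢t₀ ∘ proj₂ ∘ sumOver-X≈0⇒block I t ∣I∣) _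

    hasDim : HasDim p (InSumOver p B I) (ℓ * d ∸ 1)
    hasDim = hasDim-hyperplane (InSumOver p B I) s φ φ-s spanning equation

lemma4p2 : (k ℓ : ℕ) → 2 ≤ ℓ → ℓ < k →
    Σ ℕ λ p₀ → Σ ℕ λ d → 1 ≤ p₀ × 1 ≤ d ×
      ((p : ℕ) → Prime p → p₀ ≤ p → (𝓘 : Subset k → Bool) →
        Σ (Fin k → Fin d → Vecp (ℓ * d)) λ B →
          (∀ i → LinIndep p d (B i))
          × (∀ (I : Subset k) → ∣ I ∣ ≡ ℓ → 𝓘 I ≡ false → HasDim p (InSumOver p B I) (ℓ * d))
          × (∀ (I : Subset k) → ∣ I ∣ ≡ ℓ → 𝓘 I ≡ true → HasDim p (InSumOver p B I) (ℓ * d ∸ 1))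
          × (∀ (I : Subset k) → ∣ I ∣ ≡ suc ℓ → HasDim p (InSumOver p B I) (ℓ * d)))
lemma4p2 k (suc (suc m)) (s≤s (s≤s z≤n)) ℓ<k =
  suc (2 ^ k + k) , 2 ^ k , s≤s z≤n , m^n>0 2 k , λ p pr 2^k+k<p 𝓘 →
    let open Construction k m p {{prime⇒nonZero pr}} pr 2^k+k<p ℓ<k 𝓘
    in B , linIndep-B , hasDim-generic , DegenerateSet.hasDim , hasDim-large
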